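{- Let $\mathcal{C}$ be the class of graphs of maximum degree at most $3$ whose edge set can be partitioned into a $1$-factor (perfect matching) and vertex-disjoint cycles. Then (i) $M(3,3,\mathcal{C})=2$; and (ii) $M(C,3,\mathcal{C})\le 2$ for every integer $C\ge4$.
   Context: Consider a ring with node set $V(C_n)$ of $n$ nodes. A request graph is a simple graph $R$ whose vertices are nodes of the ring. Let $\mathcal{C}$ be a class of graphs of maximum degree at most $\Delta$. Given integers $n,C\ge1$, an assignment of nonnegative integers $A(v)$, $v\in V(C_n)$, is feasible for $\mathcal{C}$ if for every request graph $R$ belonging to $\mathcal{C}$ there exists a partition of $E(R)$ into subgraphs $B_1,\dots,B_\Lambda$ such that $|E(B_\lambda)|\le C$ for all $\lambda$ and every vertex $v$ appears in at most $A(v)$ of the subgraphs $B_\lambda$. $A(n,C,\Delta,\mathcal{C})$ is the minimum of $\sum_v A(v)$ over all such feasible assignments, and $M(C,\Delta,\mathcal{C})$ is the least positive number $M$ such that $A(n,C,\Delta,\mathcal{C})\le Mn$ for every $n\ge1$. -}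

module Defs where

open import Data.Nat using (ℕ; zero; suc; _+_; _*_; _≤_; _<_; _<ᵇ_)
open import Data.Bool using (Bool; true; false; _∧_; not; if_then_else_)
open import Data.Fin using (Fin; zero; suc; toℕ; _≟_)
open import Data.Product using (Σ; _×_; Σ-syntax)
open import Data.Sum using (_⊎_)
open import Relation.Nullary.Decidable using (⌊_⌋)
open import Relation.Binary.PropositionalEquality using (_≡_)

count : ∀ {m} → (Fin m → Bool) → ℕ
count {zero}  p = 0
count {suc m} p = (if p zero then 1 else 0) + count (λ i → p (suc i))

sumF : ∀ {m} → (Fin m → ℕ) → ℕ
sumF {zero}  f = 0
sumF {suc m} f = f zero + sumF (λ i → f (suc i))

anyF : ∀ {m} → (Fin m → Bool) → Bool
anyF {zero}  p = false
anyF {suc m} p = if p zero then true else anyF (λ i → p (suc i))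

-- A request graph: a simple graph whose vertices are ring nodes Fin n.
-- Its vertex set is taken to be the non-isolated nodes.
record SimpleGraph (n : ℕ) : Set where
  field
    edge  : Fin n → Fin n → Bool
    irrefl : ∀ u → edge u u ≡ false
    sym   : ∀ u v → edge u v ≡ edge v u
open SimpleGraph public

deg : ∀ {n} → SimpleGraph n → Fin n → ℕ
deg G v = count (edge G v)

countEdges : ∀ {n} → (Fin n → Fin n → Bool) → ℕ
countEdges {n} p = sumF (λ u → count (λ v → (toℕ u <ᵇ toℕ v) ∧ p u v))

-- M is a perfect matching (1-factor) of G, and the remaining edges E(G) ∖ M
-- form vertex-disjoint cycles (every vertex has degree 0 or 2 in E(G) ∖ M).
IsFactorPlusCycles : ∀ {n} → SimpleGraph n → (Fin n → Fin n → Bool) → Set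
IsFactorPlusCycles {n} G M =
    (∀ u v → M u v ≡ true → edge G u v ≡ true)
  × (∀ u v → M u v ≡ M v u)
  × (∀ v → count (M v) ≤ 1)
  × (∀ v → 1 ≤ deg G v → count (M v) ≡ 1)
  × (∀ v → count (λ u → edge G v u ∧ not (M v u)) ≡ 0
         ⊎ count (λ u → edge G v u ∧ not (M v u)) ≡ 2)

InClassC : ∀ {n} → SimpleGraph n → Set
InClassC {n} G =
  (∀ v → deg G v ≤ 3) × Σ[ M ∈ (Fin n → Fin n → Bool) ] IsFactorPlusCycles G M

-- A partition of E(G) into subgraphs B_0,…,B_{Λ-1} (edge e goes to B_{col e}),
-- each with at most C edges, each vertex v appearing in at most A v of them.
record GoodPartition {n} (G : SimpleGraph n) (C : ℕ) (A : Fin n → ℕ) : Set where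
  field
    Λ      : ℕ
    col    : Fin n → Fin n → Fin Λ
    colSym : ∀ u v → edge G u v ≡ true → col u v ≡ col v u
    size   : ∀ (l : Fin Λ) → countEdges (λ u v → edge G u v ∧ ⌊ col u v ≟ l ⌋) ≤ C
    load   : ∀ v → count (λ (l : Fin Λ) → anyF (λ u → edge G v u ∧ ⌊ col v u ≟ l ⌋)) ≤ A v

Feasible : (n C : ℕ) → (Fin n → ℕ) → Set
Feasible n C A = ∀ (G : SimpleGraph n) → InClassC G → GoodPartition G C A

AUpTo : (n C k : ℕ) → Set
AUpTo n C k = Σ[ A ∈ (Fin n → ℕ) ] (Feasible n C A × sumF A ≤ k)

-- A graph of class 𝒞 is a perfect matching M plus vertex-disjoint cycles H. Orient every
-- cycle of H and give each matching edge uv the part {uv, u → u⁺, v → v⁺} made of it and the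
-- arcs leaving its ends: parts have 3 edges, and a vertex lies only in its own part and in
-- the part of its predecessor on its cycle, so A ≡ 2 is feasible for every C ≥ 3.
-- Conversely, for C = 3 no two vertices u, v can both have A ≤ 1: putting K₄ on u, v and two
-- further vertices, the single part at u holds uv, ua, ub and the single part at v then also
-- holds va, four edges. So ∑ A ≥ 2n − 2, and n = 4 + 2q beats any ratio p/q < 2.

module Submission where

open import Defs hiding (sym)
open import Data.Bool using (Bool; true; false; _∧_; not; if_then_else_)
import Data.Bool as Bool
open import Data.Bool.Properties using (T-≡; ∧-conicalˡ; ∧-conicalʳ; ∧-zeroʳ)
open import Data.Empty using (⊥; ⊥-elim)
open import Data.Fin using (Fin; zero; suc; toℕ; _≟_; fromℕ; inject₁)
open import Data.Fin.Properties using (suc-injective; toℕ-injective; any?; all?)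
open import Data.List using (List; []; _∷_; length; map)
open import Data.List.Properties using (length-map)
open import Data.List.Membership.Propositional using (_∈_; _∉_)
open import Data.List.Membership.Propositional.Properties using (∈-map⁻)
open import Data.List.Relation.Unary.All using (All; []; _∷_)
import Data.List.Relation.Unary.All as All
open import Data.List.Relation.Unary.Any using (here; there)
import Data.List.Relation.Unary.Any as Any
open import Data.List.Relation.Unary.Unique.Propositional using (Unique; []; _∷_; head; tail)
open import Data.Maybe using (Maybe; just; nothing)
open import Data.Maybe.Properties using (just-injective)
open import Data.Nat using (ℕ; zero; suc; _+_; _*_; _≤_; _<_; _<ᵇ_; z≤n; s≤s; z<s; _≤?_)
import Data.Nat as ℕ
open import Data.Nat.ListAction using (sum)
open import Data.Nat.Properties hiding (_≟_; suc-injective)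
open import Algebra.Properties.CommutativeSemigroup +-commutativeSemigroup using () renaming (x∙yz≈y∙xz to x+yz≡y+xz)
open import Algebra.Properties.CommutativeSemigroup *-commutativeSemigroup using () renaming (x∙yz≈y∙xz to x*yz≡y*xz)
open import Data.Product using (_×_; _,_; proj₁; proj₂; ∃-syntax; uncurry)
import Data.Product as Product
open import Data.Product.Properties using (≡-dec)
open import Data.Sum using (_⊎_; inj₁; inj₂)
import Data.Sum as Sum
open import Function using (_∘_; id; _on_)
open import Function.Bundles using (Equivalence)
open import Level using (0ℓ)
open import Relation.Binary.Construct.Union using (_∪_)
open import Relation.Binary.Core using (Rel)
open import Relation.Binary.Definitions using (DecidableEquality; Symmetric; Decidable; tri<; tri≈; tri>)
open import Relation.Binary.PropositionalEquality
open import Relation.Nullary using (¬_; yes; no; contradiction)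
open import Relation.Nullary.Decidable using (⌊_⌋; _×-dec_; _⊎-dec_; _→-dec_; ¬?; toWitness)

indicator : Bool → ℕ
indicator b = if b then 1 else 0

indicator≤1 : ∀ b → indicator b ≤ 1
indicator≤1 true  = s≤s z≤n
indicator≤1 false = z≤n

⌊≟⌋-refl : ∀ {A : Set} (_≟ₐ_ : DecidableEquality A) x → ⌊ x ≟ₐ x ⌋ ≡ true
⌊≟⌋-refl _≟ₐ_ x with x ≟ₐ x
... | yes _  = refl
... | no x≢x = contradiction refl x≢x

⌊≟⌋-≢ : ∀ {A : Set} (_≟ₐ_ : DecidableEquality A) {x y} → x ≢ y → ⌊ x ≟ₐ y ⌋ ≡ false
⌊≟⌋-≢ _≟ₐ_ {x} {y} x≢y with x ≟ₐ y
... | yes x≡y = contradiction x≡y x≢y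
... | no _    = refl

⌊≟⌋-sound : ∀ {A : Set} (_≟ₐ_ : DecidableEquality A) {x y} → ⌊ x ≟ₐ y ⌋ ≡ true → x ≡ y
⌊≟⌋-sound _≟ₐ_ {x} {y} eq with x ≟ₐ y
... | yes x≡y = x≡y

-- Sums over Fin n and over pairs of vertices (as in countEdges) are both instances, so the
-- comparisons with sums along lists are proved once.
record Summation (I : Set) : Set where
  field
    _≟ᵢ_    : DecidableEquality I
    Σ       : (I → ℕ) → ℕ
    Σ-cong  : ∀ {f g} → (∀ i → f i ≡ g i) → Σ f ≡ Σ g
    Σ-0     : Σ (λ _ → 0) ≡ 0
    Σ-split : ∀ f x → Σ f ≡ f x + Σ (λ i → if ⌊ i ≟ᵢ x ⌋ then 0 else f i)

  without : (I → ℕ) → I → I → ℕ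
  without f x i = if ⌊ i ≟ᵢ x ⌋ then 0 else f i

  without≤ : ∀ f x i → without f x i ≤ f i
  without≤ f x i with ⌊ i ≟ᵢ x ⌋
  ... | true  = z≤n
  ... | false = ≤-refl

  Σ≤sum : ∀ f xs → (∀ i → f i ≢ 0 → i ∈ xs) → Σ f ≤ sum (map f xs)
  Σ≤sum f [] supp = ≤-reflexive (trans (Σ-cong vanish) Σ-0)
    where
    vanish : ∀ i → f i ≡ 0
    vanish i with f i ℕ.≟ 0
    ... | yes fi≡0 = fi≡0
    ... | no  fi≢0 with () ← supp i fi≢0
  Σ≤sum f (x ∷ xs) supp = begin
      Σ f                              ≡⟨ Σ-split f x ⟩
      f x + Σ (without f x)            ≤⟨ +-monoʳ-≤ (f x) (Σ≤sum (without f x) xs supp′) ⟩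
      f x + sum (map (without f x) xs) ≤⟨ +-monoʳ-≤ (f x) (sum-map-mono xs) ⟩
      f x + sum (map f xs)             ∎
    where
    open ≤-Reasoning
    sum-map-mono : ∀ ys → sum (map (without f x) ys) ≤ sum (map f ys)
    sum-map-mono []       = z≤n
    sum-map-mono (y ∷ ys) = +-mono-≤ (without≤ f x y) (sum-map-mono ys)
    supp′ : ∀ i → without f x i ≢ 0 → i ∈ xs
    supp′ i fi≢0 with i ≟ᵢ x | supp i
    ... | yes _ | _ = contradiction refl fi≢0
    ... | no i≢x | i∈x∷xs with i∈x∷xs fi≢0
    ...   | here i≡x  = contradiction i≡x i≢x
    ...   | there i∈xs = i∈xs

  sum≤Σ : ∀ f {xs} → Unique xs → sum (map f xs) ≤ Σ f
  sum≤Σ f {[]}     []             = z≤n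
  sum≤Σ f {x ∷ xs} (x∉xs ∷ uniq) = begin
      f x + sum (map f xs)              ≡⟨ cong (f x +_) (sum-map-cong x∉xs) ⟩
      f x + sum (map (without f x) xs)  ≤⟨ +-monoʳ-≤ (f x) (sum≤Σ (without f x) uniq) ⟩
      f x + Σ (without f x)             ≡⟨ Σ-split f x ⟨
      Σ f                               ∎
    where
    open ≤-Reasoning
    sum-map-cong : ∀ {ys} → All (x ≢_) ys → sum (map f ys) ≡ sum (map (without f x) ys)
    sum-map-cong []                 = refl
    sum-map-cong {y ∷ _} (x≢y ∷ ps) =
      cong₂ _+_ (cong (if_then 0 else f y) (sym (⌊≟⌋-≢ _≟ᵢ_ (x≢y ∘ sym)))) (sum-map-cong ps)

  Σ≡sum : ∀ f {xs} → Unique xs → (∀ i → f i ≢ 0 → i ∈ xs) → Σ f ≡ sum (map f xs)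
  Σ≡sum f uniq supp = ≤-antisym (Σ≤sum f _ supp) (sum≤Σ f uniq)

  Σ-indicator≤length : ∀ p xs → (∀ i → p i ≡ true → i ∈ xs) → Σ (indicator ∘ p) ≤ length xs
  Σ-indicator≤length p xs supp = ≤-trans (Σ≤sum (indicator ∘ p) xs supp′) (sum≤length xs)
    where
    supp′ : ∀ i → indicator (p i) ≢ 0 → i ∈ xs
    supp′ i pi≢0 with p i in pi
    ... | true  = supp i pi
    ... | false = contradiction refl pi≢0
    sum≤length : ∀ ys → sum (map (indicator ∘ p) ys) ≤ length ys
    sum≤length []       = z≤n
    sum≤length (y ∷ ys) = +-mono-≤ (indicator≤1 (p y)) (sum≤length ys)

  length≤Σ-indicator : ∀ p {xs} → Unique xs → (∀ {i} → i ∈ xs → p i ≡ true) → length xs ≤ Σ (indicator ∘ p)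
  length≤Σ-indicator p {xs} uniq holds = ≤-trans (≤-reflexive (length≡sum xs holds)) (sum≤Σ (indicator ∘ p) uniq)
    where
    length≡sum : ∀ ys → (∀ {i} → i ∈ ys → p i ≡ true) → length ys ≡ sum (map (indicator ∘ p) ys)
    length≡sum []       _     = refl
    length≡sum (y ∷ ys) holds′ rewrite holds′ (here refl) = cong suc (length≡sum ys (holds′ ∘ there))

⌊suc≟suc⌋ : ∀ {m} (i x : Fin m) → ⌊ suc i ≟ suc x ⌋ ≡ ⌊ i ≟ x ⌋
⌊suc≟suc⌋ i x with i ≟ x
... | yes refl = refl
... | no  _    = refl

sumF-cong : ∀ {m} {f g : Fin m → ℕ} → (∀ i → f i ≡ g i) → sumF f ≡ sumF g
sumF-cong {zero}  eq = refl
sumF-cong {suc m} eq = cong₂ _+_ (eq zero) (sumF-cong (eq ∘ suc))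

sumF-mono : ∀ {m} {f g : Fin m → ℕ} → (∀ i → f i ≤ g i) → sumF f ≤ sumF g
sumF-mono {zero}  le = z≤n
sumF-mono {suc m} le = +-mono-≤ (le zero) (sumF-mono (le ∘ suc))

sumF-0 : ∀ m → sumF {m} (λ _ → 0) ≡ 0
sumF-0 zero    = refl
sumF-0 (suc m) = sumF-0 m

sumF-const : ∀ n k → sumF {n} (λ _ → k) ≡ n * k
sumF-const zero    k = refl
sumF-const (suc n) k = cong (k +_) (sumF-const n k)

sumF-split : ∀ {m} (f : Fin m → ℕ) x → sumF f ≡ f x + sumF (λ i → if ⌊ i ≟ x ⌋ then 0 else f i)
sumF-split {suc m} f zero    = refl
sumF-split {suc m} f (suc x) = begin
    f zero + sumF (f ∘ suc)                             ≡⟨ cong (f zero +_) (sumF-split (f ∘ suc) x) ⟩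
    f zero + (f (suc x) + sumF (λ i → if ⌊ i ≟ x ⌋ then 0 else f (suc i)))
      ≡⟨ x+yz≡y+xz (f zero) (f (suc x)) _ ⟩
    f (suc x) + (f zero + sumF (λ i → if ⌊ i ≟ x ⌋ then 0 else f (suc i)))
      ≡⟨ cong (λ s → f (suc x) + (f zero + s)) (sumF-cong λ i → cong (if_then 0 else f (suc i)) (sym (⌊suc≟suc⌋ i x))) ⟩
    f (suc x) + (f zero + sumF (λ i → if ⌊ suc i ≟ suc x ⌋ then 0 else f (suc i))) ∎
  where open ≡-Reasoning

finSummation : ∀ m → Summation (Fin m)
finSummation m = record
  { _≟ᵢ_ = _≟_ ; Σ = sumF ; Σ-cong = sumF-cong ; Σ-0 = sumF-0 m ; Σ-split = sumF-split }

⌊≡-dec⌋ : ∀ {A B : Set} (_≟ᵃ_ : DecidableEquality A) (_≟ᵇ_ : DecidableEquality B) u v x y →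
          ⌊ ≡-dec _≟ᵃ_ _≟ᵇ_ (u , v) (x , y) ⌋ ≡ ⌊ u ≟ᵃ x ⌋ ∧ ⌊ v ≟ᵇ y ⌋
⌊≡-dec⌋ _≟ᵃ_ _≟ᵇ_ u v x y with u ≟ᵃ x | v ≟ᵇ y | ≡-dec _≟ᵃ_ _≟ᵇ_ (u , v) (x , y)
... | yes _    | yes _    | yes _  = refl
... | yes refl | yes refl | no ≢   = contradiction refl ≢
... | yes _    | no v≢y   | yes eq = contradiction (cong proj₂ eq) v≢y
... | yes _    | no _     | no _   = refl
... | no u≢x   | _        | yes eq = contradiction (cong proj₁ eq) u≢x
... | no _     | _        | no _   = refl

_⊗_ : ∀ {I J} → Summation I → Summation J → Summation (I × J)
_⊗_ {I} {J} S T = record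
  { _≟ᵢ_    = _≟ᵢⱼ_
  ; Σ       = Σ²
  ; Σ-cong  = λ eq → S.Σ-cong λ u → T.Σ-cong λ v → eq (u , v)
  ; Σ-0     = trans (S.Σ-cong λ _ → T.Σ-0) S.Σ-0
  ; Σ-split = Σ²-split
  }
  where
  module S = Summation S
  module T = Summation T
  _≟ᵢⱼ_ : DecidableEquality (I × J)
  _≟ᵢⱼ_ = ≡-dec S._≟ᵢ_ T._≟ᵢ_
  Σ² : (I × J → ℕ) → ℕ
  Σ² F = S.Σ λ u → T.Σ λ v → F (u , v)
  Σ²-split : ∀ F z → Σ² F ≡ F z + Σ² (λ i → if ⌊ i ≟ᵢⱼ z ⌋ then 0 else F i)
  Σ²-split F (x , y) = begin
    S.Σ row                                           ≡⟨ S.Σ-split row x ⟩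
    row x + S.Σ (S.without row x)                     ≡⟨ cong (_+ S.Σ (S.without row x)) (T.Σ-split (λ v → F (x , v)) y) ⟩
    (F (x , y) + T.Σ (T.without (λ v → F (x , v)) y)) + S.Σ (S.without row x)
      ≡⟨ +-assoc (F (x , y)) _ _ ⟩
    F (x , y) + (T.Σ (T.without (λ v → F (x , v)) y) + S.Σ (S.without row x))
      ≡⟨ cong (F (x , y) +_) (cong₂ _+_ (T.Σ-cong row-x) (S.Σ-cong other-rows)) ⟩
    F (x , y) + (row′ x + S.Σ (S.without row′ x))     ≡⟨ cong (F (x , y) +_) (S.Σ-split row′ x) ⟨
    F (x , y) + S.Σ row′                              ∎
    where
    open ≡-Reasoning
    F′ : I × J → ℕ
    F′ i = if ⌊ i ≟ᵢⱼ (x , y) ⌋ then 0 else F i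
    row row′ : I → ℕ
    row  u = T.Σ λ v → F (u , v)
    row′ u = T.Σ λ v → F′ (u , v)
    row-x : ∀ v → T.without (λ v → F (x , v)) y v ≡ F′ (x , v)
    row-x v rewrite ⌊≡-dec⌋ S._≟ᵢ_ T._≟ᵢ_ x v x y | ⌊≟⌋-refl S._≟ᵢ_ x = refl
    other-rows : ∀ u → S.without row x u ≡ S.without row′ x u
    other-rows u with ⌊ u S.≟ᵢ x ⌋ in u≟x
    ... | true  = refl
    ... | false = T.Σ-cong λ v →
      cong (if_then 0 else F (u , v)) (sym (trans (⌊≡-dec⌋ S._≟ᵢ_ T._≟ᵢ_ u v x y) (cong (_∧ ⌊ v T.≟ᵢ y ⌋) u≟x)))

count≡sumF : ∀ {m} (p : Fin m → Bool) → count p ≡ sumF (indicator ∘ p)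
count≡sumF {zero}  p = refl
count≡sumF {suc m} p = cong (indicator (p zero) +_) (count≡sumF (p ∘ suc))

module _ {m : ℕ} where
  open Summation (finSummation m)

  count≤length : (p : Fin m → Bool) (xs : List (Fin m)) → (∀ i → p i ≡ true → i ∈ xs) → count p ≤ length xs
  count≤length p xs supp = ≤-trans (≤-reflexive (count≡sumF p)) (Σ-indicator≤length p xs supp)

  length≤count : (p : Fin m → Bool) {xs : List (Fin m)} → Unique xs → (∀ {i} → i ∈ xs → p i ≡ true) → length xs ≤ count p
  length≤count p uniq holds = ≤-trans (length≤Σ-indicator p uniq holds) (≤-reflexive (sym (count≡sumF p)))

  count≤1⇒unique : (p : Fin m → Bool) → count p ≤ 1 → ∀ {a b} → p a ≡ true → p b ≡ true → a ≡ b
  count≤1⇒unique p count≤1 {a} {b} pa pb with a ≟ b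
  ... | yes a≡b = a≡b
  ... | no  a≢b = contradiction (≤-trans (length≤count p ((a≢b ∷ []) ∷ [] ∷ []) holds) count≤1) (<⇒≱ ≤-refl)
    where
    holds : ∀ {i} → i ∈ a ∷ b ∷ [] → p i ≡ true
    holds (here refl)         = pa
    holds (there (here refl)) = pb

<ᵇ-true : ∀ {m n} → m < n → (m <ᵇ n) ≡ true
<ᵇ-true m<n = Equivalence.to T-≡ (<⇒<ᵇ m<n)

<ᵇ-false : ∀ {m n} → ¬ m < n → (m <ᵇ n) ≡ false
<ᵇ-false {m} {n} m≮n with m <ᵇ n in eq
... | true  = contradiction (<ᵇ⇒< m n (Equivalence.from T-≡ eq)) m≮n
... | false = refl

sortPair : ∀ {m} → Fin m → Fin m → Fin m × Fin m
sortPair x y = if toℕ x <ᵇ toℕ y then (x , y) else (y , x)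

sortPair-< : ∀ {m} {x y : Fin m} → toℕ x < toℕ y → sortPair x y ≡ (x , y)
sortPair-< x<y rewrite <ᵇ-true x<y = refl

sortPair-> : ∀ {m} {x y : Fin m} → toℕ y < toℕ x → sortPair x y ≡ (y , x)
sortPair-> y<x rewrite <ᵇ-false (<⇒≯ y<x) = refl

sortPair-comm : ∀ {m} (x y : Fin m) → sortPair x y ≡ sortPair y x
sortPair-comm x y with <-cmp (toℕ x) (toℕ y)
... | tri< x<y _ _ = trans (sortPair-< x<y) (sym (sortPair-> x<y))
... | tri≈ _ x≡y _ rewrite toℕ-injective x≡y = refl
... | tri> _ _ y<x = trans (sortPair-> y<x) (sym (sortPair-< y<x))

sortPair-injective : ∀ {m} {x y x′ y′ : Fin m} → sortPair x y ≡ sortPair x′ y′ →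
                     (x ≡ x′ × y ≡ y′) ⊎ (x ≡ y′ × y ≡ x′)
sortPair-injective {x = x} {y} {x′} {y′} eq with toℕ x <ᵇ toℕ y | toℕ x′ <ᵇ toℕ y′ | eq
... | true  | true  | refl = inj₁ (refl , refl)
... | true  | false | refl = inj₂ (refl , refl)
... | false | true  | refl = inj₂ (refl , refl)
... | false | false | refl = inj₁ (refl , refl)

sortPair-sel : ∀ {m} (x y : Fin m) → proj₁ (sortPair x y) ≡ x ⊎ proj₁ (sortPair x y) ≡ y
sortPair-sel x y with toℕ x <ᵇ toℕ y
... | true  = inj₁ refl
... | false = inj₂ refl

countEdges≡Σ² : ∀ {m} (q : Fin m → Fin m → Bool) →
                countEdges q ≡ Summation.Σ (finSummation m ⊗ finSummation m) (λ (u , v) → indicator ((toℕ u <ᵇ toℕ v) ∧ q u v))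
countEdges≡Σ² q = sumF-cong λ u → count≡sumF (λ v → (toℕ u <ᵇ toℕ v) ∧ q u v)

module _ {m : ℕ} (q : Fin m → Fin m → Bool) where
  open Summation (finSummation m ⊗ finSummation m)

  countEdges≤length : (ps : List (Fin m × Fin m)) → (∀ u v → q u v ≡ true → sortPair u v ∈ ps) →
                      countEdges q ≤ length ps
  countEdges≤length ps covers = begin
    countEdges q                                         ≡⟨ countEdges≡Σ² q ⟩
    Σ (λ (u , v) → indicator ((toℕ u <ᵇ toℕ v) ∧ q u v)) ≤⟨ Σ-indicator≤length _ ps supp ⟩
    length ps                                            ∎
    where
    open ≤-Reasoning
    supp : ∀ ((u , v) : Fin m × Fin m) → (toℕ u <ᵇ toℕ v) ∧ q u v ≡ true → (u , v) ∈ ps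
    supp (u , v) u<v∧quv = subst (_∈ ps) (sortPair-< (<ᵇ⇒< (toℕ u) (toℕ v) (Equivalence.from T-≡ u<v)))
                                 (covers u v (∧-conicalʳ _ _ u<v∧quv))
      where u<v = ∧-conicalˡ _ _ u<v∧quv

  length≤countEdges : (es : List (Fin m × Fin m)) → Unique (map (uncurry sortPair) es) →
                      (∀ {x y} → (x , y) ∈ es → x ≢ y × q x y ≡ true × q y x ≡ true) → length es ≤ countEdges q
  length≤countEdges es uniq edges = begin
    length es                                            ≡⟨ length-map _ es ⟨
    length (map (uncurry sortPair) es)                   ≤⟨ length≤Σ-indicator _ uniq holds ⟩
    Σ (λ (u , v) → indicator ((toℕ u <ᵇ toℕ v) ∧ q u v)) ≡⟨ countEdges≡Σ² q ⟨
    countEdges q                                         ∎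
    where
    open ≤-Reasoning
    holds : ∀ {i} → i ∈ map (uncurry sortPair) es → (toℕ (proj₁ i) <ᵇ toℕ (proj₂ i)) ∧ q (proj₁ i) (proj₂ i) ≡ true
    holds i∈ with ∈-map⁻ _ i∈
    ... | (x , y) , xy∈es , refl with edges xy∈es | <-cmp (toℕ x) (toℕ y)
    ...   | _ , qxy , _   | tri< x<y _ _ rewrite sortPair-< x<y | <ᵇ-true x<y = qxy
    ...   | x≢y , _ , _   | tri≈ _ x≡y _ = contradiction (toℕ-injective x≡y) x≢y
    ...   | _ , _ , qyx   | tri> _ _ y<x rewrite sortPair-> y<x | <ᵇ-true y<x = qyx

record IsMaxDegree2 {n} (H : Rel (Fin n) 0ℓ) : Set where
  field
    symmetric   : Symmetric H
    irreflexive : ∀ {v} → ¬ H v v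
    decidable   : Decidable H
    degree≤2    : ∀ {v a b c} → H v a → H v b → H v c → a ≡ b ⊎ a ≡ c ⊎ b ≡ c

record IsLinearArcs {n} (H : Rel (Fin n) 0ℓ) (arc : Fin n → Fin n → Bool) : Set where
  field
    arc⇒edge   : ∀ {u v} → arc u v ≡ true → H u v
    arc-asym   : ∀ {u v} → arc u v ≡ true → arc v u ≡ false
    out-unique : ∀ {v a b} → arc v a ≡ true → arc v b ≡ true → a ≡ b
    in-unique  : ∀ {v a b} → arc a v ≡ true → arc b v ≡ true → a ≡ b

record Orientation {n} (H : Rel (Fin n) 0ℓ) : Set where
  field
    arc    : Fin n → Fin n → Bool
    linear : IsLinearArcs H arc
    covers : ∀ {u v} → H u v → arc u v ≡ true ⊎ arc v u ≡ true
  open IsLinearArcs linear public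

pointsTo : ∀ {n} → Maybe (Fin n) → Fin n → Bool
pointsTo nothing  j = false
pointsTo (just p) j = ⌊ j ≟ p ⌋

pointsTo-sound : ∀ {n} (t : Maybe (Fin n)) {j} → pointsTo t j ≡ true → t ≡ just j
pointsTo-sound (just p) eq = cong just (sym (⌊≟⌋-sound _≟_ eq))

pointsTo-just : ∀ {n} (p : Fin n) → pointsTo (just p) p ≡ true
pointsTo-just p = ⌊≟⌋-refl _≟_ p

pointsTo-other : ∀ {n} (t : Maybe (Fin n)) {j} → t ≢ just j → pointsTo t j ≡ false
pointsTo-other nothing  t≢j = refl
pointsTo-other (just p) t≢j = ⌊≟⌋-≢ _≟_ (λ j≡p → t≢j (cong just (sym j≡p)))

extend : ∀ {n} → (Fin n → Fin n → Bool) → (t s : Maybe (Fin n)) → Fin (suc n) → Fin (suc n) → Bool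
extend arc t s zero    zero    = false
extend arc t s zero    (suc j) = pointsTo t j
extend arc t s (suc i) zero    = pointsTo s i
extend arc t s (suc i) (suc j) = arc i j

module _ {n} {H : Rel (Fin (suc n)) 0ℓ} {arc : Fin n → Fin n → Bool} (L : IsLinearArcs (H on suc) arc)
         (t s : Maybe (Fin n))
         (t-edge : ∀ {p} → t ≡ just p → H zero (suc p))
         (s-edge : ∀ {q} → s ≡ just q → H (suc q) zero)
         (t≢s    : ∀ {p} → t ≡ just p → s ≢ just p)
         (t-no-in  : ∀ {p j} → t ≡ just p → arc j p ≡ false)
         (s-no-out : ∀ {q j} → s ≡ just q → arc q j ≡ false)
         where
  open IsLinearArcs L

  extend-linear : IsLinearArcs H (extend arc t s)
  extend-linear = record
    { arc⇒edge   = λ {u v} → arc⇒edge′ {u} {v}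
    ; arc-asym   = λ {u v} → arc-asym′ {u} {v}
    ; out-unique = λ {v a b} → out-unique′ {v} {a} {b}
    ; in-unique  = λ {v a b} → in-unique′ {v} {a} {b}
    }
    where
    arc⇒edge′ : ∀ {u v} → extend arc t s u v ≡ true → H u v
    arc⇒edge′ {zero}  {suc j} e = t-edge (pointsTo-sound t e)
    arc⇒edge′ {suc i} {zero}  e = s-edge (pointsTo-sound s e)
    arc⇒edge′ {suc i} {suc j} e = arc⇒edge e

    arc-asym′ : ∀ {u v} → extend arc t s u v ≡ true → extend arc t s v u ≡ false
    arc-asym′ {zero}  {suc j} e = pointsTo-other s (t≢s (pointsTo-sound t e))
    arc-asym′ {suc i} {zero}  e = pointsTo-other t λ t≡i → t≢s t≡i (pointsTo-sound s e)
    arc-asym′ {suc i} {suc j} e = arc-asym e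

    out-unique′ : ∀ {v a b} → extend arc t s v a ≡ true → extend arc t s v b ≡ true → a ≡ b
    out-unique′ {zero}  {suc a} {suc b} ea eb =
      cong suc (just-injective (trans (sym (pointsTo-sound t ea)) (pointsTo-sound t eb)))
    out-unique′ {suc v} {zero}  {zero}  ea eb = refl
    out-unique′ {suc v} {zero}  {suc b} ea eb = contradiction (trans (sym eb) (s-no-out (pointsTo-sound s ea))) λ ()
    out-unique′ {suc v} {suc a} {zero}  ea eb = contradiction (trans (sym ea) (s-no-out (pointsTo-sound s eb))) λ ()
    out-unique′ {suc v} {suc a} {suc b} ea eb = cong suc (out-unique ea eb)

    in-unique′ : ∀ {v a b} → extend arc t s a v ≡ true → extend arc t s b v ≡ true → a ≡ b
    in-unique′ {zero}  {suc a} {suc b} ea eb =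
      cong suc (just-injective (trans (sym (pointsTo-sound s ea)) (pointsTo-sound s eb)))
    in-unique′ {suc v} {zero}  {zero}  ea eb = refl
    in-unique′ {suc v} {zero}  {suc b} ea eb = contradiction (trans (sym eb) (t-no-in (pointsTo-sound t ea))) λ ()
    in-unique′ {suc v} {suc a} {zero}  ea eb = contradiction (trans (sym ea) (t-no-in (pointsTo-sound t eb))) λ ()
    in-unique′ {suc v} {suc a} {suc b} ea eb = cong suc (in-unique ea eb)

_≟₂_ : ∀ {n} → DecidableEquality (Fin n × Fin n)
_≟₂_ = ≡-dec _≟_ _≟_

removeArc-linear : ∀ {n} {K H : Rel (Fin n) 0ℓ} {arc} (p q : Fin n) → IsLinearArcs K arc →
                   (∀ {i j} → arc i j ≡ true → (i , j) ≢ (p , q) → H i j) →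
                   IsLinearArcs H (λ i j → arc i j ∧ not ⌊ (i , j) ≟₂ (p , q) ⌋)
removeArc-linear {arc = arc} p q L kept = record
  { arc⇒edge   = λ e → kept (∧-conicalˡ _ _ e) (notRemoved e)
  ; arc-asym   = λ {i j} e → cong (_∧ not ⌊ (j , i) ≟₂ (p , q) ⌋) (arc-asym (∧-conicalˡ _ _ e))
  ; out-unique = λ ea eb → out-unique (∧-conicalˡ _ _ ea) (∧-conicalˡ _ _ eb)
  ; in-unique  = λ ea eb → in-unique (∧-conicalˡ _ _ ea) (∧-conicalˡ _ _ eb)
  }
  where
  open IsLinearArcs L
  notRemoved : ∀ {i j} → arc i j ∧ not ⌊ (i , j) ≟₂ (p , q) ⌋ ≡ true → (i , j) ≢ (p , q)
  notRemoved e refl with (p , q) ≟₂ (p , q)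
  ... | yes _ = contradiction (trans (sym (∧-zeroʳ (arc p q))) e) λ ()
  ... | no pq≢pq = pq≢pq refl

Link : ∀ {n} → Fin n → Fin n → Rel (Fin n) 0ℓ
Link p q i j = (i ≡ p × j ≡ q) ⊎ (i ≡ q × j ≡ p)

data Neighbours {n} (H : Rel (Fin (suc n)) 0ℓ) : Set where
  isolated : (∀ {j} → ¬ H zero (suc j)) → Neighbours H
  leaf     : ∀ a → H zero (suc a) → (∀ {j} → H zero (suc j) → j ≡ a) → Neighbours H
  inner    : ∀ p q → p ≢ q → H zero (suc p) → H zero (suc q) →
             (∀ {j} → H zero (suc j) → j ≡ p ⊎ j ≡ q) → Neighbours H

module _ {n} {H : Rel (Fin (suc n)) 0ℓ} (G : IsMaxDegree2 H) where
  open IsMaxDegree2 G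

  delete₀ : IsMaxDegree2 (H on suc)
  delete₀ = record
    { symmetric   = symmetric
    ; irreflexive = irreflexive
    ; decidable   = λ i j → decidable (suc i) (suc j)
    ; degree≤2    = λ ha hb hc → Sum.map suc-injective (Sum.map suc-injective suc-injective) (degree≤2 ha hb hc)
    }

  other-neighbour-unique : ∀ {v x y} → H v zero → H v (suc x) → H v (suc y) → x ≡ y
  other-neighbour-unique h₀ hx hy with degree≤2 h₀ hx hy
  ... | inj₂ (inj₂ sx≡sy) = suc-injective sx≡sy

  neighbours : Neighbours H
  neighbours with any? (λ j → decidable zero (suc j))
  ... | no none = isolated λ h → none (_ , h)
  ... | yes (a , ha) with any? (λ j → decidable zero (suc j) ×-dec ¬? (j ≟ a))
  ...   | no onlyA = leaf a ha only
    where
    only : ∀ {j} → H zero (suc j) → j ≡ a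
    only {j} hj with j ≟ a
    ... | yes j≡a = j≡a
    ... | no  j≢a = contradiction (j , hj , j≢a) onlyA
  ...   | yes (b , hb , b≢a) = inner a b (b≢a ∘ sym) ha hb either
    where
    either : ∀ {j} → H zero (suc j) → j ≡ a ⊎ j ≡ b
    either hj with degree≤2 ha hb hj
    ... | inj₁ sa≡sb        = contradiction (suc-injective (sym sa≡sb)) b≢a
    ... | inj₂ (inj₁ sa≡sj) = inj₁ (suc-injective (sym sa≡sj))
    ... | inj₂ (inj₂ sb≡sj) = inj₂ (suc-injective (sym sb≡sj))

  suppress₀ : ∀ {p q} → p ≢ q → H zero (suc p) → H zero (suc q) → IsMaxDegree2 ((H on suc) ∪ Link p q)
  suppress₀ {p} {q} p≢q hp hq = record
    { symmetric   = Sum.map symmetric link-sym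
    ; irreflexive = λ { (inj₁ h) → irreflexive h ; (inj₂ (inj₁ (refl , v≡q))) → p≢q v≡q ; (inj₂ (inj₂ (refl , v≡p))) → p≢q (sym v≡p) }
    ; decidable   = λ i j → decidable (suc i) (suc j) ⊎-dec ((i ≟ p ×-dec j ≟ q) ⊎-dec (i ≟ q ×-dec j ≟ p))
    ; degree≤2    = degree≤2′
    }
    where
    link-sym : Symmetric (Link p q)
    link-sym = Sum.swap ∘ Sum.map Product.swap Product.swap
    link-unique : ∀ {v x y} → Link p q v x → Link p q v y → x ≡ y
    link-unique (inj₁ (refl , refl)) (inj₁ (_ , refl))    = refl
    link-unique (inj₁ (refl , refl)) (inj₂ (p≡q , _))    = contradiction p≡q p≢q
    link-unique (inj₂ (refl , refl)) (inj₁ (q≡p , _))    = contradiction (sym q≡p) p≢q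
    link-unique (inj₂ (refl , refl)) (inj₂ (_ , refl))    = refl
    link-zero : ∀ {v x} → Link p q v x → H (suc v) zero
    link-zero (inj₁ (refl , _)) = symmetric hp
    link-zero (inj₂ (refl , _)) = symmetric hq
    degree≤2′ : ∀ {v a b c} → ((H on suc) ∪ Link p q) v a → ((H on suc) ∪ Link p q) v b →
                ((H on suc) ∪ Link p q) v c → a ≡ b ⊎ a ≡ c ⊎ b ≡ c
    degree≤2′ {v} (inj₁ ha) (inj₁ hb) (inj₁ hc) = IsMaxDegree2.degree≤2 delete₀ ha hb hc
    degree≤2′ (inj₂ la) (inj₂ lb) _         = inj₁ (link-unique la lb)
    degree≤2′ (inj₂ la) (inj₁ _)  (inj₂ lc) = inj₂ (inj₁ (link-unique la lc))
    degree≤2′ (inj₁ _)  (inj₂ lb) (inj₂ lc) = inj₂ (inj₂ (link-unique lb lc))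
    degree≤2′ (inj₂ la) (inj₁ hb) (inj₁ hc) = inj₂ (inj₂ (other-neighbour-unique (link-zero la) hb hc))
    degree≤2′ (inj₁ ha) (inj₂ lb) (inj₁ hc) = inj₂ (inj₁ (other-neighbour-unique (link-zero lb) ha hc))
    degree≤2′ (inj₁ ha) (inj₁ hb) (inj₂ lc) = inj₁ (other-neighbour-unique (link-zero lc) ha hb)

  extension-orientation : ∀ {arc t s} → IsLinearArcs H (extend arc t s) →
                          (∀ {i j} → H (suc i) (suc j) → arc i j ≡ true ⊎ arc j i ≡ true) →
                          (∀ {j} → H zero (suc j) → pointsTo t j ≡ true ⊎ pointsTo s j ≡ true) → Orientation H
  extension-orientation {arc} {t} {s} L covers at-zero = record { arc = extend arc t s ; linear = L ; covers = covers′ }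
    where
    covers′ : ∀ {u v} → H u v → extend arc t s u v ≡ true ⊎ extend arc t s v u ≡ true
    covers′ {zero}  {zero}  h = contradiction h irreflexive
    covers′ {zero}  {suc j} h = at-zero h
    covers′ {suc i} {zero}  h = Sum.swap (at-zero (symmetric h))
    covers′ {suc i} {suc j} h = covers h

  orient-isolated : Orientation (H on suc) → (∀ {j} → ¬ H zero (suc j)) → Orientation H
  orient-isolated R none = extension-orientation
    (extend-linear linear nothing nothing (λ ()) (λ ()) (λ ()) (λ ()) (λ ())) covers (λ h → contradiction h none)
    where open Orientation R

  -- The only neighbour a of 0 has at most one arc in the rest: point 0 at a, or a at 0.
  orient-leaf : Orientation (H on suc) → ∀ a → H zero (suc a) → (∀ {j} → H zero (suc j) → j ≡ a) → Orientation H
  orient-leaf R a ha only with any? (λ j → arc a j Bool.≟ true)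
    where open Orientation R
  ... | yes (j₀ , a→j₀) = extension-orientation
    (extend-linear linear (just a) nothing (λ { refl → ha }) (λ ()) (λ { refl () }) no-in (λ ())) covers
    (λ hj → inj₁ (subst (λ j → pointsTo (just a) j ≡ true) (sym (only hj)) (pointsTo-just a)))
    where
    open Orientation R
    no-in : ∀ {p j} → just a ≡ just p → arc j p ≡ false
    no-in {j = j} refl with arc j a in j→a
    ... | false = refl
    ... | true with other-neighbour-unique (symmetric ha) (arc⇒edge a→j₀) (symmetric (arc⇒edge j→a))
    ...   | refl = contradiction (trans (sym j→a) (arc-asym a→j₀)) λ ()
  ... | no no-out = extension-orientation
    (extend-linear linear nothing (just a) (λ ()) (λ { refl → symmetric ha }) (λ ()) (λ ()) (λ { refl → no-arc })) covers
    (λ hj → inj₂ (subst (λ j → pointsTo (just a) j ≡ true) (sym (only hj)) (pointsTo-just a)))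
    where
    open Orientation R
    no-arc : ∀ {j} → arc a j ≡ false
    no-arc {j} with arc a j in a→j
    ... | false = refl
    ... | true  = contradiction (j , a→j) no-out

  module _ {p q} (p≢q : p ≢ q) (hp : H zero (suc p)) (hq : H zero (suc q))
           (either : ∀ {j} → H zero (suc j) → j ≡ p ⊎ j ≡ q) where

    private
      at-zero : ∀ {j} → H zero (suc j) → pointsTo (just p) j ≡ true ⊎ pointsTo (just q) j ≡ true
      at-zero hj with either hj
      ... | inj₁ refl = inj₁ (pointsTo-just p)
      ... | inj₂ refl = inj₂ (pointsTo-just q)

    -- The neighbours p, q of 0 are adjacent, so p → q closes up to the cycle 0 → p → q → 0.
    orient-triangle : (R : Orientation (H on suc)) → H (suc p) (suc q) → Orientation.arc R p q ≡ true → Orientation H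
    orient-triangle R hpq p→q = extension-orientation
      (extend-linear linear (just p) (just q) (λ { refl → hp }) (λ { refl → symmetric hq })
        (λ { refl q≡p → p≢q (sym (just-injective q≡p)) }) (λ { refl → no-in }) (λ { refl → no-out }))
      covers at-zero
      where
      open Orientation R
      no-in : ∀ {j} → arc j p ≡ false
      no-in {j} with arc j p in j→p
      ... | false = refl
      ... | true with other-neighbour-unique (symmetric hp) (symmetric (arc⇒edge j→p)) hpq
      ...   | refl = contradiction (trans (sym j→p) (arc-asym p→q)) λ ()
      no-out : ∀ {j} → arc q j ≡ false
      no-out {j} with arc q j in q→j
      ... | false = refl
      ... | true with other-neighbour-unique (symmetric hq) (arc⇒edge q→j) (symmetric hpq)
      ...   | refl = contradiction (trans (sym q→j) (arc-asym p→q)) λ ()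

    -- The neighbours p, q of 0 are not adjacent: orient the graph with 0 replaced by an
    -- edge p – q, then reroute the arc p → q as p → 0 → q.
    orient-path : ∀ {K} (R : Orientation K) → (∀ {i j} → K i j → H (suc i) (suc j) ⊎ Link p q i j) →
                  (∀ {i j} → H (suc i) (suc j) → K i j) → ¬ H (suc p) (suc q) → Orientation.arc R p q ≡ true → Orientation H
    orient-path R K⊆ ⊆K ¬hpq p→q = extension-orientation
      (extend-linear (removeArc-linear p q linear kept) (just q) (just p) (λ { refl → hq }) (λ { refl → symmetric hp })
        (λ { refl p≡q → p≢q (just-injective p≡q) }) (λ { refl → no-in }) (λ { refl → no-out }))
      covers′ (Sum.swap ∘ at-zero)
      where
      open Orientation R
      arc′ : Fin n → Fin n → Bool
      arc′ i j = arc i j ∧ not ⌊ (i , j) ≟₂ (p , q) ⌋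
      kept : ∀ {i j} → arc i j ≡ true → (i , j) ≢ (p , q) → H (suc i) (suc j)
      kept i→j ij≢pq with K⊆ (arc⇒edge i→j)
      ... | inj₁ h                  = h
      ... | inj₂ (inj₁ (refl , refl)) = contradiction refl ij≢pq
      ... | inj₂ (inj₂ (refl , refl)) = contradiction (trans (sym i→j) (arc-asym p→q)) λ ()
      removed : arc′ p q ≡ false
      removed rewrite ⌊≟⌋-refl _≟₂_ (p , q) = ∧-zeroʳ (arc p q)
      no-in : ∀ {j} → arc′ j q ≡ false
      no-in {j} with arc j q in j→q
      ... | false = refl
      ... | true with in-unique j→q p→q
      ...   | refl = trans (cong (_∧ _) (sym j→q)) removed
      no-out : ∀ {j} → arc′ p j ≡ false
      no-out {j} with arc p j in p→j
      ... | false = refl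
      ... | true with out-unique p→q p→j
      ...   | refl = trans (cong (_∧ _) (sym p→j)) removed
      keep : ∀ {i j} → arc i j ≡ true → H (suc i) (suc j) → arc′ i j ≡ true
      keep {i} {j} i→j h rewrite i→j with (i , j) ≟₂ (p , q)
      ... | yes refl = contradiction h ¬hpq
      ... | no _     = refl
      covers′ : ∀ {i j} → H (suc i) (suc j) → arc′ i j ≡ true ⊎ arc′ j i ≡ true
      covers′ h = Sum.map (λ i→j → keep i→j h) (λ j→i → keep j→i (symmetric h)) (covers (⊆K h))

  private
    orient-adjacent : ∀ {p q} → p ≢ q → H zero (suc p) → H zero (suc q) → (∀ {j} → H zero (suc j) → j ≡ p ⊎ j ≡ q) →
                      Orientation (H on suc) → H (suc p) (suc q) → Orientation H
    orient-adjacent p≢q hp hq either R hpq with Orientation.covers R hpq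
    ... | inj₁ p→q = orient-triangle p≢q hp hq either R hpq p→q
    ... | inj₂ q→p = orient-triangle (p≢q ∘ sym) hq hp (Sum.swap ∘ either) R (symmetric hpq) q→p

    orient-apart : ∀ {p q} → p ≢ q → H zero (suc p) → H zero (suc q) → (∀ {j} → H zero (suc j) → j ≡ p ⊎ j ≡ q) →
                   Orientation ((H on suc) ∪ Link p q) → ¬ H (suc p) (suc q) → Orientation H
    orient-apart p≢q hp hq either R ¬hpq with Orientation.covers R (inj₂ (inj₁ (refl , refl)))
    ... | inj₁ p→q = orient-path p≢q hp hq either R id inj₁ ¬hpq p→q
    ... | inj₂ q→p = orient-path (p≢q ∘ sym) hq hp (Sum.swap ∘ either) R (Sum.map₂ Sum.swap) inj₁ (¬hpq ∘ symmetric) q→p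

  orientation-step : (∀ {K : Rel (Fin n) 0ℓ} → IsMaxDegree2 K → Orientation K) → Orientation H
  orientation-step orient with neighbours
  ... | isolated none  = orient-isolated (orient delete₀) none
  ... | leaf a ha only = orient-leaf (orient delete₀) a ha only
  ... | inner p q p≢q hp hq either with decidable (suc p) (suc q)
  ...   | yes hpq = orient-adjacent p≢q hp hq either (orient delete₀) hpq
  ...   | no ¬hpq = orient-apart p≢q hp hq either (orient (suppress₀ p≢q hp hq)) ¬hpq

orientation : ∀ {n} {H : Rel (Fin n) 0ℓ} → IsMaxDegree2 H → Orientation H
orientation {zero}  G = record
  { arc = λ _ _ → false
  ; linear = record { arc⇒edge = λ () ; arc-asym = λ () ; out-unique = λ () ; in-unique = λ () }
  ; covers = λ { {()} }
  }
orientation {suc n} G = orientation-step G orientation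

choose : ∀ {m} → (Fin m → Bool) → Fin m → Fin m
choose p d with any? (λ i → p i Bool.≟ true)
... | yes (i , _) = i
... | no  _       = d

choose-true : ∀ {m} (p : Fin m → Bool) d {i} → p i ≡ true → p (choose p d) ≡ true
choose-true p d {i} pi with any? (λ i → p i Bool.≟ true)
... | yes (_ , pj) = pj
... | no  none     = contradiction (i , pi) none

choose-default : ∀ {m} (p : Fin m → Bool) d → p (choose p d) ≡ true ⊎ choose p d ≡ d
choose-default p d with any? (λ i → p i Bool.≟ true)
... | yes (_ , pj) = inj₁ pj
... | no  _        = inj₂ refl

anyF-witness : ∀ {m} (p : Fin m → Bool) → anyF p ≡ true → ∃[ i ] p i ≡ true
anyF-witness {suc m} p any with p zero in p0
... | true  = zero , p0
... | false = Product.map suc id (anyF-witness (p ∘ suc) any)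

anyF-intro : ∀ {m} (p : Fin m → Bool) i → p i ≡ true → anyF p ≡ true
anyF-intro p zero    pi rewrite pi = refl
anyF-intro p (suc i) pi with p zero
... | true  = refl
... | false = anyF-intro (p ∘ suc) i pi

module _ {n} (G : SimpleGraph n) (M : Fin n → Fin n → Bool) (M-sym : ∀ u v → M u v ≡ M v u)
         (M-matching : ∀ v → count (M v) ≤ 1) (rest≤2 : ∀ v → count (λ u → edge G v u ∧ not (M v u)) ≤ 2) where

  Rest : Rel (Fin n) 0ℓ
  Rest u v = edge G u v ∧ not (M u v) ≡ true

  rest-maxDegree2 : IsMaxDegree2 Rest
  rest-maxDegree2 = record
    { symmetric   = λ {u} {v} h → trans (cong₂ (λ e m → e ∧ not m) (SimpleGraph.sym G v u) (M-sym v u)) h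
    ; irreflexive = λ {v} h → contradiction (trans (sym h) (cong (_∧ _) (irrefl G v))) λ ()
    ; decidable   = λ u v → edge G u v ∧ not (M u v) Bool.≟ true
    ; degree≤2    = degree≤2
    }
    where
    degree≤2 : ∀ {v a b c} → Rest v a → Rest v b → Rest v c → a ≡ b ⊎ a ≡ c ⊎ b ≡ c
    degree≤2 {v} {a} {b} {c} ha hb hc with a ≟ b | a ≟ c | b ≟ c
    ... | yes a≡b | _       | _       = inj₁ a≡b
    ... | no _    | yes a≡c | _       = inj₂ (inj₁ a≡c)
    ... | no _    | no _    | yes b≡c = inj₂ (inj₂ b≡c)
    ... | no a≢b  | no a≢c  | no b≢c  =
      contradiction (length≤count _ ((a≢b ∷ a≢c ∷ []) ∷ (b≢c ∷ []) ∷ [] ∷ []) three) (<⇒≱ (s≤s (rest≤2 v)))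
      where
      three : ∀ {i} → i ∈ a ∷ b ∷ c ∷ [] → edge G v i ∧ not (M v i) ≡ true
      three (here refl)                 = ha
      three (there (here refl))         = hb
      three (there (there (here refl))) = hc

  unmatched⇒rest : ∀ {u v} → edge G u v ≡ true → M u v ≡ false → Rest u v
  unmatched⇒rest uv m rewrite uv | m = refl

  open Orientation (orientation rest-maxDegree2)

  partner : Fin n → Fin n
  partner v = choose (M v) v

  partner-unique : ∀ {u v} → M u v ≡ true → partner u ≡ v
  partner-unique {u} uv = count≤1⇒unique (M u) (M-matching u) (choose-true (M u) u uv) uv

  partner-involutive : ∀ v → partner (partner v) ≡ v
  partner-involutive v with choose-default (M v) v
  ... | inj₁ v-pv  = partner-unique (trans (M-sym (partner v) v) v-pv)
  ... | inj₂ pv≡v  = trans (cong partner pv≡v) pv≡v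

  -- Each pair {v, partner v} names one part, by its smaller vertex (an unmatched v is its own partner).
  name : Fin n → Fin n
  name v = proj₁ (sortPair v (partner v))

  name-partner : ∀ v → name (partner v) ≡ name v
  name-partner v = cong proj₁ (trans (cong (sortPair (partner v)) (partner-involutive v)) (sortPair-comm (partner v) v))

  name-inverse : ∀ {v l} → name v ≡ l → v ≡ l ⊎ v ≡ partner l
  name-inverse {v} refl with sortPair-sel v (partner v)
  ... | inj₁ nv≡v  = inj₁ (sym nv≡v)
  ... | inj₂ nv≡pv = inj₂ (trans (sym (partner-involutive v)) (cong partner (sym nv≡pv)))

  out inn : Fin n → Fin n
  out v = choose (arc v) v
  inn v = choose (λ u → arc u v) v

  out-unique′ : ∀ {v w} → arc v w ≡ true → out v ≡ w
  out-unique′ {v} vw = out-unique (choose-true (arc v) v vw) vw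

  inn-unique : ∀ {v u} → arc u v ≡ true → inn v ≡ u
  inn-unique {v} uv = in-unique (choose-true (λ u → arc u v) v uv) uv

  -- An arc u → v joins the part of its tail; a matching edge joins the part of its pair.
  part : Fin n → Fin n → Fin n
  part u v = if arc v u then name v else name u

  part-sym : ∀ u v → edge G u v ≡ true → part u v ≡ part v u
  part-sym u v uv with arc v u in v→u | arc u v in u→v
  ... | true  | true  = contradiction (trans (sym u→v) (arc-asym v→u)) λ ()
  ... | true  | false = refl
  ... | false | true  = refl
  ... | false | false = trans (sym (name-partner u)) (cong name (partner-unique matched))
    where
    matched : M u v ≡ true
    matched with M u v in m
    ... | true  = refl
    ... | false with covers (unmatched⇒rest uv m)
    ...   | inj₁ u→v′ = contradiction (trans (sym u→v′) u→v) λ ()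
    ...   | inj₂ v→u′ = contradiction (trans (sym v→u′) v→u) λ ()

  partEdges : Fin n → List (Fin n × Fin n)
  partEdges l = sortPair l (partner l) ∷ sortPair l (out l) ∷ sortPair (partner l) (out (partner l)) ∷ []

  edge∈partEdges : ∀ {u v l} → edge G u v ≡ true → part u v ≡ l → sortPair u v ∈ partEdges l
  edge∈partEdges {u} {v} uv uv∈l with arc v u in v→u
  ... | true with name-inverse uv∈l
  ...   | inj₁ refl = there (here (trans (sortPair-comm u v) (cong (sortPair v) (sym (out-unique′ v→u)))))
  ...   | inj₂ refl = there (there (here (trans (sortPair-comm u v) (cong (sortPair v) (sym (out-unique′ v→u))))))
  edge∈partEdges {u} {v} uv uv∈l | false with M u v in m | name-inverse uv∈l
  ... | true  | inj₁ refl = here (cong (sortPair u) (sym (partner-unique m)))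
  ... | true  | inj₂ refl = here (trans (cong (sortPair u) (trans (sym (partner-unique m)) (partner-involutive _)))
                                        (sortPair-comm u _))
  ... | false | l-or-pl with covers (unmatched⇒rest uv m)
  ...   | inj₂ v→u′ = contradiction (trans (sym v→u′) v→u) λ ()
  ...   | inj₁ u→v with l-or-pl
  ...     | inj₁ refl = there (here (cong (sortPair u) (sym (out-unique′ u→v))))
  ...     | inj₂ refl = there (there (here (cong (sortPair u) (sym (out-unique′ u→v)))))

  part∈names : ∀ v u → part v u ∈ name v ∷ name (inn v) ∷ []
  part∈names v u with arc u v in u→v
  ... | true  = there (here (cong name (sym (inn-unique u→v))))
  ... | false = here refl

  load2Partition : ∀ C → 3 ≤ C → GoodPartition G C (λ _ → 2)
  load2Partition C 3≤C = record
    { Λ = n ; col = part ; colSym = part-sym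
    ; size = λ l → ≤-trans (countEdges≤length _ (partEdges l) λ u v e →
                     edge∈partEdges (∧-conicalˡ _ _ e) (⌊≟⌋-sound _≟_ (∧-conicalʳ _ _ e))) 3≤C
    ; load = λ v → count≤length _ (name v ∷ name (inn v) ∷ []) λ l e → used v l e
    }
    where
    used : ∀ v l → anyF (λ u → edge G v u ∧ ⌊ part v u ≟ l ⌋) ≡ true → l ∈ name v ∷ name (inn v) ∷ []
    used v l e with anyF-witness _ e
    ... | u , vu∈l = subst (_∈ _) (⌊≟⌋-sound _≟_ (∧-conicalʳ _ _ vu∈l)) (part∈names v u)

feasible-load2 : ∀ n C → 3 ≤ C → Feasible n C (λ _ → 2)
feasible-load2 n C 3≤C G (_ , M , _ , M-sym , M-matching , _ , rest-0or2) =
  load2Partition G M M-sym M-matching (λ v → ≤2 (rest-0or2 v)) C 3≤C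
  where
  ≤2 : ∀ {k} → k ≡ 0 ⊎ k ≡ 2 → k ≤ 2
  ≤2 (inj₁ refl) = z≤n
  ≤2 (inj₂ refl) = ≤-refl

upperBound : ∀ C → 3 ≤ C → ∀ n → AUpTo n C (2 * n)
upperBound C 3≤C n = (λ _ → 2) , feasible-load2 n C 3≤C , ≤-reflexive (trans (sumF-const n 2) (*-comm n 2))

module _ {n} {G : SimpleGraph n} {C} {A : Fin n → ℕ} (P : GoodPartition G C A) where
  open GoodPartition P

  light⇒samePart : ∀ {x y z} → A x ≤ 1 → edge G x y ≡ true → edge G x z ≡ true → col x y ≡ col x z
  light⇒samePart {x} {y} {z} Ax≤1 xy xz with col x y ≟ col x z
  ... | yes same = same
  ... | no  different = contradiction (≤-trans (length≤count _ ((different ∷ []) ∷ [] ∷ []) meets) (≤-trans (load x) Ax≤1))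
                                      (<⇒≱ ≤-refl)
    where
    meets : ∀ {l} → l ∈ col x y ∷ col x z ∷ [] → anyF (λ w → edge G x w ∧ ⌊ col x w ≟ l ⌋) ≡ true
    meets (here refl)         = anyF-intro _ y (trans (cong (_∧ ⌊ col x y ≟ col x y ⌋) xy) (⌊≟⌋-refl _≟_ (col x y)))
    meets (there (here refl)) = anyF-intro _ z (trans (cong (_∧ ⌊ col x z ≟ col x z ⌋) xz) (⌊≟⌋-refl _≟_ (col x z)))

  inPart-sym : ∀ {l x y} → edge G x y ∧ ⌊ col x y ≟ l ⌋ ≡ true → edge G y x ∧ ⌊ col y x ≟ l ⌋ ≡ true
  inPart-sym {l} {x} {y} e = trans (cong₂ (λ e c → e ∧ ⌊ c ≟ l ⌋) (SimpleGraph.sym G y x) (sym (colSym x y xy))) e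
    where xy = ∧-conicalˡ _ _ e

-- K₄ on the vertices 0–3 of Fin 5; vertex 4 stands for every vertex outside the gadget.
outside : Fin 5
outside = fromℕ 4

inK₄ : Fin 5 → Bool
inK₄ i = not ⌊ i ≟ outside ⌋

K₄ : Fin 5 → Fin 5 → Bool
K₄ i j = inK₄ i ∧ inK₄ j ∧ not ⌊ i ≟ j ⌋

K₄-matching : Fin 5 → Fin 5 → Bool
K₄-matching zero                   (suc zero)             = true
K₄-matching (suc zero)             zero                   = true
K₄-matching (suc (suc zero))       (suc (suc (suc zero))) = true
K₄-matching (suc (suc (suc zero))) (suc (suc zero))       = true
K₄-matching _                      _                      = false

count₄ : (Fin 5 → Bool) → ℕ
count₄ t = count (t ∘ inject₁)

K₄-sym : ∀ i j → K₄ i j ≡ K₄ j i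
K₄-sym = toWitness {a? = all? λ i → all? λ j → K₄ i j Bool.≟ K₄ j i} _

K₄-irrefl : ∀ i → K₄ i i ≡ false
K₄-irrefl = toWitness {a? = all? λ i → K₄ i i Bool.≟ false} _

K₄-matching-sym : ∀ i j → K₄-matching i j ≡ K₄-matching j i
K₄-matching-sym = toWitness {a? = all? λ i → all? λ j → K₄-matching i j Bool.≟ K₄-matching j i} _

K₄-matching⊆K₄ : ∀ i j → K₄-matching i j ≡ true → K₄ i j ≡ true
K₄-matching⊆K₄ = toWitness {a? = all? λ i → all? λ j → K₄-matching i j Bool.≟ true →-dec K₄ i j Bool.≟ true} _

K₄-isolates-outside : ∀ i → K₄ i outside ≡ false × K₄-matching i outside ≡ false
K₄-isolates-outside = toWitness {a? = all? λ i → K₄ i outside Bool.≟ false ×-dec K₄-matching i outside Bool.≟ false} _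

K₄-degree≤3 : ∀ i → count₄ (K₄ i) ≤ 3
K₄-degree≤3 = toWitness {a? = all? λ i → count₄ (K₄ i) ≤? 3} _

K₄-matching-degree≤1 : ∀ i → count₄ (K₄-matching i) ≤ 1
K₄-matching-degree≤1 = toWitness {a? = all? λ i → count₄ (K₄-matching i) ≤? 1} _

K₄-matching-perfect : ∀ i → 1 ≤ count₄ (K₄ i) → count₄ (K₄-matching i) ≡ 1
K₄-matching-perfect = toWitness {a? = all? λ i → 1 ≤? count₄ (K₄ i) →-dec count₄ (K₄-matching i) ℕ.≟ 1} _

K₄-rest-degree : ∀ i → count₄ (λ j → K₄ i j ∧ not (K₄-matching i j)) ≡ 0
                     ⊎ count₄ (λ j → K₄ i j ∧ not (K₄-matching i j)) ≡ 2
K₄-rest-degree = toWitness {a? = all? λ i → count₄ (λ j → K₄ i j ∧ not (K₄-matching i j)) ℕ.≟ 0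
                                         ⊎-dec count₄ (λ j → K₄ i j ∧ not (K₄-matching i j)) ℕ.≟ 2} _

module K₄Gadget {n} (u v a b : Fin n) (distinct : Unique (u ∷ v ∷ a ∷ b ∷ [])) where

  private
    u≢v : u ≢ v
    u≢v = All.lookup (head distinct) (here refl)
    u≢a : u ≢ a
    u≢a = All.lookup (head distinct) (there (here refl))
    u≢b : u ≢ b
    u≢b = All.lookup (head distinct) (there (there (here refl)))
    v≢a : v ≢ a
    v≢a = All.lookup (head (tail distinct)) (here refl)
    v≢b : v ≢ b
    v≢b = All.lookup (head (tail distinct)) (there (here refl))
    a≢b : a ≢ b
    a≢b = All.lookup (head (tail (tail distinct))) (here refl)

  label : Fin n → Fin 5
  label x = if ⌊ x ≟ u ⌋ then zero else if ⌊ x ≟ v ⌋ then suc zero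
            else if ⌊ x ≟ a ⌋ then suc (suc zero) else if ⌊ x ≟ b ⌋ then suc (suc (suc zero)) else outside

  label-u : label u ≡ zero
  label-u rewrite ⌊≟⌋-refl _≟_ u = refl

  label-v : label v ≡ suc zero
  label-v rewrite ⌊≟⌋-≢ _≟_ (u≢v ∘ sym) | ⌊≟⌋-refl _≟_ v = refl

  label-a : label a ≡ suc (suc zero)
  label-a rewrite ⌊≟⌋-≢ _≟_ (u≢a ∘ sym) | ⌊≟⌋-≢ _≟_ (v≢a ∘ sym) | ⌊≟⌋-refl _≟_ a = refl

  label-b : label b ≡ suc (suc (suc zero))
  label-b rewrite ⌊≟⌋-≢ _≟_ (u≢b ∘ sym) | ⌊≟⌋-≢ _≟_ (v≢b ∘ sym) | ⌊≟⌋-≢ _≟_ (a≢b ∘ sym) | ⌊≟⌋-refl _≟_ b = refl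

  label-outside : ∀ x → label x ≢ outside → x ∈ u ∷ v ∷ a ∷ b ∷ []
  label-outside x inside with x ≟ u
  ... | yes x≡u = here x≡u
  ... | no _ with x ≟ v
  ...   | yes x≡v = there (here x≡v)
  ...   | no _ with x ≟ a
  ...     | yes x≡a = there (there (here x≡a))
  ...     | no _ with x ≟ b
  ...       | yes x≡b = there (there (there (here x≡b)))
  ...       | no _    = contradiction refl inside

  count-label : ∀ t → t outside ≡ false → count (t ∘ label) ≡ count₄ t
  count-label t t-outside = begin
    count (t ∘ label)                                           ≡⟨ count≡sumF (t ∘ label) ⟩
    sumF (indicator ∘ t ∘ label)                                ≡⟨ Σ≡sum (indicator ∘ t ∘ label) distinct supp ⟩
    sum (map (indicator ∘ t ∘ label) (u ∷ v ∷ a ∷ b ∷ []))      ≡⟨ sum-labels ⟩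
    count₄ t                                                    ∎
    where
    open ≡-Reasoning
    open Summation (finSummation n) using (Σ≡sum)
    supp : ∀ x → indicator (t (label x)) ≢ 0 → x ∈ u ∷ v ∷ a ∷ b ∷ []
    supp x counted = label-outside x λ x-outside → counted (cong indicator (trans (cong t x-outside) t-outside))
    sum-labels : sum (map (indicator ∘ t ∘ label) (u ∷ v ∷ a ∷ b ∷ [])) ≡ count₄ t
    sum-labels rewrite label-u | label-v | label-a | label-b = refl

  graph : SimpleGraph n
  graph = record
    { edge   = λ x y → K₄ (label x) (label y)
    ; irrefl = λ x → K₄-irrefl (label x)
    ; sym    = λ x y → K₄-sym (label x) (label y)
    }

  graph∈C : InClassC graph
  graph∈C = (λ x → subst (_≤ 3) (sym (degree x)) (K₄-degree≤3 (label x)))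
          , matching
          , (λ x y → K₄-matching⊆K₄ (label x) (label y))
          , (λ x y → K₄-matching-sym (label x) (label y))
          , (λ x → subst (_≤ 1) (sym (matching-degree x)) (K₄-matching-degree≤1 (label x)))
          , (λ x d → trans (matching-degree x) (K₄-matching-perfect (label x) (subst (1 ≤_) (degree x) d)))
          , (λ x → subst (λ k → k ≡ 0 ⊎ k ≡ 2) (sym (rest-degree x)) (K₄-rest-degree (label x)))
    where
    matching : Fin n → Fin n → Bool
    matching x y = K₄-matching (label x) (label y)
    degree : ∀ x → deg graph x ≡ count₄ (K₄ (label x))
    degree x = count-label (K₄ (label x)) (proj₁ (K₄-isolates-outside (label x)))
    matching-degree : ∀ x → count (matching x) ≡ count₄ (K₄-matching (label x))
    matching-degree x = count-label (K₄-matching (label x)) (proj₂ (K₄-isolates-outside (label x)))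
    rest-degree : ∀ x → count (λ y → edge graph x y ∧ not (matching x y))
                      ≡ count₄ (λ j → K₄ (label x) j ∧ not (K₄-matching (label x) j))
    rest-degree x = count-label (λ j → K₄ (label x) j ∧ not (K₄-matching (label x) j))
                                (cong (_∧ not (K₄-matching (label x) outside)) (proj₁ (K₄-isolates-outside (label x))))

  private
    edge-uv : edge graph u v ≡ true
    edge-uv rewrite label-u | label-v = refl
    edge-ua : edge graph u a ≡ true
    edge-ua rewrite label-u | label-a = refl
    edge-ub : edge graph u b ≡ true
    edge-ub rewrite label-u | label-b = refl
    edge-va : edge graph v a ≡ true
    edge-va rewrite label-v | label-a = refl

  noLightPair : ∀ {A} → GoodPartition graph 3 A → A u ≤ 1 → A v ≤ 1 → ⊥
  noLightPair P Au≤1 Av≤1 = contradiction (≤-trans four (size c)) (<⇒≱ ≤-refl)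
    where
    open GoodPartition P
    c : Fin Λ
    c = col u v
    inPart : Fin n → Fin n → Bool
    inPart x y = edge graph x y ∧ ⌊ col x y ≟ c ⌋
    inPart-intro : ∀ {x y} → edge graph x y ≡ true → col x y ≡ c → inPart x y ≡ true
    inPart-intro {x} {y} xy xy∈c = trans (cong₂ (λ e l → e ∧ ⌊ l ≟ c ⌋) xy xy∈c) (⌊≟⌋-refl _≟_ c)
    ua∈c : col u a ≡ c
    ua∈c = sym (light⇒samePart P Au≤1 edge-uv edge-ua)
    ub∈c : col u b ≡ c
    ub∈c = sym (light⇒samePart P Au≤1 edge-uv edge-ub)
    va∈c : col v a ≡ c
    va∈c = trans (sym (light⇒samePart P Av≤1 (trans (SimpleGraph.sym graph v u) edge-uv) edge-va)) (sym (colSym u v edge-uv))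
    es : List (Fin n × Fin n)
    es = (u , v) ∷ (u , a) ∷ (u , b) ∷ (v , a) ∷ []
    sortPair-≢ : ∀ {x y x′ y′} → (x ≢ x′ ⊎ y ≢ y′) → (x ≢ y′ ⊎ y ≢ x′) → sortPair x y ≢ sortPair x′ y′
    sortPair-≢ not-same not-swapped eq with sortPair-injective eq
    ... | inj₁ (x≡x′ , y≡y′) = Sum.[ (λ ≢ → ≢ x≡x′) , (λ ≢ → ≢ y≡y′) ] not-same
    ... | inj₂ (x≡y′ , y≡x′) = Sum.[ (λ ≢ → ≢ x≡y′) , (λ ≢ → ≢ y≡x′) ] not-swapped
    es-distinct : Unique (map (uncurry sortPair) es)
    es-distinct = (sortPair-≢ (inj₂ v≢a) (inj₁ u≢a) ∷ sortPair-≢ (inj₂ v≢b) (inj₁ u≢b) ∷ sortPair-≢ (inj₁ u≢v) (inj₁ u≢a) ∷ [])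
                ∷ (sortPair-≢ (inj₂ a≢b) (inj₁ u≢b) ∷ sortPair-≢ (inj₁ u≢v) (inj₁ u≢a) ∷ [])
                ∷ (sortPair-≢ (inj₁ u≢v) (inj₁ u≢a) ∷ []) ∷ [] ∷ []
    both : ∀ {x y} → edge graph x y ≡ true → col x y ≡ c → inPart x y ≡ true × inPart y x ≡ true
    both xy xy∈c = inPart-intro xy xy∈c , inPart-sym P (inPart-intro xy xy∈c)
    es-in-c : ∀ {x y} → (x , y) ∈ es → x ≢ y × inPart x y ≡ true × inPart y x ≡ true
    es-in-c (here refl)                         = u≢v , both edge-uv refl
    es-in-c (there (here refl))                 = u≢a , both edge-ua ua∈c
    es-in-c (there (there (here refl)))         = u≢b , both edge-ub ub∈c
    es-in-c (there (there (there (here refl)))) = v≢a , both edge-va va∈c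
    four : 4 ≤ countEdges inPart
    four = length≤countEdges inPart es es-distinct es-in-c

module _ {m : ℕ} where
  open import Data.List.Membership.DecPropositional (_≟_ {m}) using (_∈?_)

  fresh : ∀ (ys : List (Fin m)) {xs} → Unique xs → length ys < length xs → ∃[ x ] x ∉ ys
  fresh ys {xs} distinct longer with Any.any? (λ x → ¬? (x ∈? ys)) xs
  ... | yes some = Any.satisfied some
  ... | no  none = contradiction (≤-trans (length≤count (λ x → ⌊ x ∈? ys ⌋) distinct covered)
                                         (count≤length _ ys λ x → toWitness ∘ Equivalence.from T-≡))
                                 (<⇒≱ longer)
    where
    covered : ∀ {x} → x ∈ xs → ⌊ x ∈? ys ⌋ ≡ true
    covered {x} x∈xs with x ∈? ys
    ... | yes _   = refl
    ... | no  x∉ys = contradiction (Any.map (λ { refl → x∉ys }) x∈xs) none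

extendDistinct : ∀ {k} {u v : Fin (4 + k)} → u ≢ v → ∃[ a ] ∃[ b ] Unique (u ∷ v ∷ a ∷ b ∷ [])
extendDistinct {u = u} {v} u≢v
  with a , a∉uv  ← fresh (u ∷ v ∷ []) {zero ∷ suc zero ∷ suc (suc zero) ∷ []}
                         (((λ ()) ∷ (λ ()) ∷ []) ∷ ((λ ()) ∷ []) ∷ [] ∷ []) (s≤s (s≤s (s≤s z≤n)))
  with b , b∉uva ← fresh (u ∷ v ∷ a ∷ []) {zero ∷ suc zero ∷ suc (suc zero) ∷ suc (suc (suc zero)) ∷ []}
                         (((λ ()) ∷ (λ ()) ∷ (λ ()) ∷ []) ∷ ((λ ()) ∷ (λ ()) ∷ []) ∷ ((λ ()) ∷ []) ∷ [] ∷ [])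
                         (s≤s (s≤s (s≤s (s≤s z≤n))))
  = a , b , (u≢v ∷ (a∉uv ∘ here ∘ sym) ∷ (b∉uva ∘ here ∘ sym) ∷ [])
          ∷ ((a∉uv ∘ there ∘ here ∘ sym) ∷ (b∉uva ∘ there ∘ here ∘ sym) ∷ [])
          ∷ ((b∉uva ∘ there ∘ there ∘ here ∘ sym) ∷ []) ∷ [] ∷ []

lightPair-infeasible : ∀ {k} (A : Fin (4 + k) → ℕ) → Feasible (4 + k) 3 A → ∀ {u v} → u ≢ v → A u ≤ 1 → A v ≤ 1 → ⊥
lightPair-infeasible A feasible {u} {v} u≢v Au≤1 Av≤1 = onGadget (extendDistinct u≢v)
  where
  onGadget : ∃[ a ] ∃[ b ] Unique (u ∷ v ∷ a ∷ b ∷ []) → ⊥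
  onGadget (a , b , distinct) = noLightPair (feasible graph graph∈C) Au≤1 Av≤1
    where open K₄Gadget u v a b distinct

atMostOneLight : ∀ {k} (A : Fin (4 + k) → ℕ) → Feasible (4 + k) 3 A → ∀ {u v} → u ≢ v → 2 ≤ A u ⊎ 2 ≤ A v
atMostOneLight A feasible {u} {v} u≢v with 2 ≤? A u | 2 ≤? A v
... | yes 2≤Au | _        = inj₁ 2≤Au
... | no  _    | yes 2≤Av = inj₂ 2≤Av
... | no  2≰Au | no  2≰Av = ⊥-elim (lightPair-infeasible A feasible u≢v (light 2≰Au) (light 2≰Av))
  where
  light : ∀ {x} → ¬ 2 ≤ A x → A x ≤ 1
  light 2≰Ax = ≤-pred (≰⇒> 2≰Ax)

sumF-atMostOneLight : ∀ {n} (A : Fin n → ℕ) → (∀ {u v} → u ≢ v → 2 ≤ A u ⊎ 2 ≤ A v) → 2 * n ≤ sumF A + 2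
sumF-atMostOneLight {zero}  A heavy = z≤n
sumF-atMostOneLight {suc n} A heavy with 2 ≤? A zero
... | yes 2≤A0 = begin
    2 * suc n                     ≡⟨ *-suc 2 n ⟩
    2 + 2 * n                     ≤⟨ +-mono-≤ 2≤A0 (sumF-atMostOneLight (A ∘ suc) (λ u≢v → heavy (u≢v ∘ suc-injective))) ⟩
    A zero + (sumF (A ∘ suc) + 2) ≡⟨ +-assoc (A zero) _ 2 ⟨
    sumF A + 2                    ∎
  where open ≤-Reasoning
... | no 2≰A0 = begin
    2 * suc n                ≡⟨ *-comm 2 (suc n) ⟩
    suc n * 2                ≡⟨ sumF-const (suc n) 2 ⟨
    2 + sumF {n} (λ _ → 2)   ≤⟨ +-monoʳ-≤ 2 (sumF-mono others) ⟩
    2 + sumF (A ∘ suc)       ≤⟨ +-monoʳ-≤ 2 (m≤n+m _ (A zero)) ⟩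
    2 + sumF A               ≡⟨ +-comm 2 (sumF A) ⟩
    sumF A + 2               ∎
  where
  open ≤-Reasoning
  others : ∀ i → 2 ≤ A (suc i)
  others i = Sum.[ (λ 2≤A0 → contradiction 2≤A0 2≰A0) , id ] (heavy {zero} {suc i} λ ())

ratio-bound : ∀ p q S → p < 2 * q → 2 * (4 + 2 * q) ≤ S + 2 → p * (4 + 2 * q) < q * S
ratio-bound p q S p<2q 2N≤S+2 = +-cancelʳ-< N (p * N) (q * S) (begin-strict
    p * N + N      ≡⟨ +-comm (p * N) N ⟩
    suc p * N      ≤⟨ *-monoˡ-≤ N p<2q ⟩
    2 * q * N      ≡⟨ *-assoc 2 q N ⟩
    2 * (q * N)    ≡⟨ x*yz≡y*xz 2 q N ⟩
    q * (2 * N)    ≤⟨ *-monoʳ-≤ q 2N≤S+2 ⟩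
    q * (S + 2)    ≡⟨ *-distribˡ-+ q S 2 ⟩
    q * S + q * 2  <⟨ +-monoʳ-< (q * S) (subst (_< N) (*-comm 2 q) (m<n+m (2 * q) {4} z<s)) ⟩
    q * S + N      ∎)
  where
  open ≤-Reasoning
  N = 4 + 2 * q

lowerBound : ∀ p q → p < 2 * q → ∃[ n ] (1 ≤ n × (∀ (A : Fin n → ℕ) → Feasible n 3 A → p * n < q * sumF A))
lowerBound p q p<2q = 4 + 2 * q , s≤s z≤n , λ A feasible →
  ratio-bound p q (sumF A) p<2q (sumF-atMostOneLight A (atMostOneLight A feasible))

corollary3 :
    ( (∀ (n : ℕ) → 1 ≤ n → AUpTo n 3 (2 * n))
    × (∀ (p q : ℕ) → 1 ≤ q → p < 2 * q →
         ∃[ n ] (1 ≤ n × (∀ (A : Fin n → ℕ) → Feasible n 3 A → p * n < q * sumF A))) )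
    × (∀ (C : ℕ) → 4 ≤ C → ∀ (n : ℕ) → 1 ≤ n → AUpTo n C (2 * n))
-- The hypothesis 1 ≤ q is implied by p < 2 * q.
corollary3 = ( (λ n _ → upperBound 3 ≤-refl n)
             , (λ p q _ → lowerBound p q) )
           , (λ C 4≤C n _ → upperBound C (≤-trans (n≤1+n 3) 4≤C) n)
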